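{- For every integer $k\ge1$, $$a_{k,k}=\sum_{T\in\mathcal{T}_k}\ \prod_{v\in V_T} b_v^{\,\delta_{v,T}},$$ where $b_1=-1$ and $b_v=2^{ -2}\big(2^{2(v-1)}-1\big)^{ -1}$ for all $v>1$.
   Context: Let $\epsilon(k)=1$ if $k$ is even and $0$ if $k$ is odd. The numbers $a_{k,k}$ ($k\ge1$) are defined recursively by $a_{1,1}=-1$ and, for $k\ge2$, $a_{k,k}=b_k\Big(\epsilon(k)\,a_{k/2,k/2}^2+2\sum_{s=1}^{\lfloor (k-1)/2\rfloor}a_{s,s}\,a_{k-s,k-s}\Big)$ (the first term being $0$ for odd $k$), with $b_k=2^{ -2}(2^{2(k-1)}-1)^{ -1}$. (These are the leading coefficients in the expansion $c_{n,2k}=\sum_{j=1}^k a_{j,k}2^{2jn}$ of the coefficient of $x^{2k}$ in $p_n(x)$, where $p_0=x^2-2$, $p_n=p_{n-1}^2-2$.) For $k\ge1$, $\mathcal{T}_k$ is the set of ordered (plane) rooted trees whose nodes are labeled by positive integers such that: the root is labeled $k$; every node labeled $1$ is a leaf; every node labeled $v\ge2$ has exactly two ordered children, whose labels sum to $v$. (So $\mathcal{T}_1$ consists of a single node labeled $1$, and $|\mathcal{T}_k|$ is the $(k-1)$-th Catalan number.) For $T\in\mathcal{T}_k$, $V_T$ is the set of integers appearing as labels of nodes of $T$, and for $v\in V_T$, $\delta_{v,T}$ is the number of nodes of $T$ labeled $v$. -}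

module Defs where

open import Data.Nat as ℕ using (ℕ; zero; suc; _+_; _∸_; _^_; _≤?_; NonZero; _>_; s≤s)
open import Data.Nat.Properties using (+-suc; m^n>0; _≟_)
open import Data.Nat.DivMod using (_%_; _/_)
open import Data.Integer using (+_)
open import Data.Rational as ℚ using (ℚ; 0ℚ; 1ℚ)
open import Data.List using (List; []; _∷_; _++_; map; foldr; upTo; deduplicate; filter; length)
open import Relation.Nullary using (yes; no)
open import Relation.Binary.PropositionalEquality using (_≡_; refl; subst; sym)

sumℚ : List ℚ → ℚ
sumℚ = foldr ℚ._+_ 0ℚ

productℚ : List ℚ → ℚ
productℚ = foldr ℚ._*_ 1ℚ

_^ℚ_ : ℚ → ℕ → ℚ
q ^ℚ zero  = 1ℚ
q ^ℚ suc n = q ℚ.* (q ^ℚ n)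

range1 : ℕ → List ℕ
range1 m = map suc (upTo m)

-- b_v :  b_1 = -1,  b_v = 2^{-2} (2^{2(v-1)} - 1)^{-1} = 1 / (4 (2^{2(v-1)} - 1))  (v ≥ 2)
-- (b_0 is never used; set to 0.)

nz-lemma : ∀ y → y > 0 → NonZero (4 ℕ.* (2 ℕ.* y ∸ 1))
nz-lemma (suc y) _ rewrite +-suc y (y + 0) = _

bden : ℕ → ℕ
bden j = 4 ℕ.* (2 ^ (2 ℕ.* suc j) ∸ 1)

bden-nz : ∀ j → NonZero (bden j)
bden-nz j = nz-lemma (2 ^ (j + suc (j + 0))) (m^n>0 2 (j + suc (j + 0)))

b : ℕ → ℚ
b zero          = 0ℚ
b (suc zero)    = ℚ.- 1ℚ
b (suc (suc j)) = ℚ._/_ (+ 1) (bden j) {{bden-nz j}}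

-- a_{k,k}, by course-of-values recursion.
-- step k f computes a_{k,k} from f s = a_{s,s} (s < k):
--   a_{1,1} = -1,
--   a_{k,k} = b_k ( ε(k) a_{k/2,k/2}^2 + 2 Σ_{s=1}^{⌊(k-1)/2⌋} a_{s,s} a_{k-s,k-s} )   (k ≥ 2)

step : ℕ → (ℕ → ℚ) → ℚ
step zero          f = 0ℚ
step (suc zero)    f = ℚ.- 1ℚ
step k@(suc (suc _)) f =
  b k ℚ.* (evenTerm ℚ.+ (ℚ._/_ (+ 2) 1 ℚ.*
     sumℚ (map (λ s → f s ℚ.* f (k ∸ s)) (range1 ((k ∸ 1) / 2)))))
  where
  evenTerm : ℚ
  evenTerm with k % 2 ≟ 0
  ... | yes _ = f (k / 2) ℚ.* f (k / 2)
  ... | no  _ = 0ℚ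

-- aTab n i = a_{i,i} for 1 ≤ i ≤ n
aTab : ℕ → ℕ → ℚ
aTab zero    i = 0ℚ
aTab (suc n) i with i ≤? n
... | yes _ = aTab n i
... | no  _ = step (suc n) (aTab n)

a : ℕ → ℚ
a k = aTab k k

-- Trees in 𝒯_k : ordered rooted trees, root labelled k, nodes labelled by
-- positive integers, nodes labelled 1 are leaves, a node labelled v ≥ 2 has
-- exactly two ordered children with positive labels summing to v.
-- Tree v is the type of such trees whose root has label v.

data Tree : ℕ → Set where
  leaf : Tree 1
  node : ∀ {l r} → Tree (suc l) → Tree (suc r) → Tree (suc l + suc r)

labels : ∀ {v} → Tree v → List ℕ
labels {v} leaf       = v ∷ []
labels {v} (node l r) = v ∷ (labels l ++ labels r)

V : ∀ {v} → Tree v → List ℕ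
V t = deduplicate _≟_ (labels t)

δ : ∀ {v} → ℕ → Tree v → ℕ
δ u t = length (filter (_≟ u) (labels t))

weight : ∀ {v} → Tree v → ℚ
weight t = productℚ (map (λ u → b u ^ℚ δ u t) (V t))

{-# OPTIONS --safe #-}
-- Cutting a tree of 𝒯_k (k ≥ 2) at its root identifies 𝒯_k with the disjoint union over
-- l + r = k of 𝒯_l × 𝒯_r, and ∏_{v ∈ V_T} b_v ^ δ_{v,T} is just the product of b over all
-- nodes of T.  Hence the tree sums S_k satisfy S_1 = b_1 = -1 and S_k = b_k Σ_{l+r=k} S_l S_r.
-- The recursion for a_{k,k} is the same convolution folded in half, because the summand
-- a_{s,s} a_{k-s,k-s} is symmetric under s ↦ k - s; so a_{k,k} = S_k by induction on k.
-- Any duplicate-free complete list of 𝒯_k is a permutation of an explicit enumeration,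
-- so its sum is S_k.
module Submission where

open import Defs
open import Algebra.Bundles using (CommutativeMonoid)
open import Data.Nat as ℕ using (ℕ; zero; suc; pred; _∸_; _≤_; _<_; _≥_; _≤?_; z≤n; s≤s)
open import Data.Nat.Properties as ℕₚ using (_≟_)
open import Data.Nat.DivMod
  using (_%_; _/_; m≡m%n+[m/n]*n; m%n<n; m*n/n≡m; m*n%n≡0; [m+kn]%n≡m%n; m/n≡1+[m∸n]/n)
open import Data.Nat.Tactic.RingSolver using (solve-∀)
import Data.Integer as ℤ
open import Data.Rational as ℚ using (ℚ; 0ℚ; 1ℚ; _+_; _*_)
import Data.Rational.Properties as ℚₚ
open import Data.Rational.Solver using (module +-*-Solver)
open import Data.List
  using ( List; []; _∷_; _++_; map; concatMap; cartesianProductWith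
        ; applyUpTo; applyDownFrom; upTo; reverse; filter; length)
open import Data.List.Properties
  using (map-++; map-∘; map-cong; map-cong-local; map-upTo; reverse-applyUpTo; filter-accept; filter-reject)
open import Data.List.Membership.Propositional using (_∈_)
open import Data.List.Membership.Propositional.Properties
  using (∈-++⁺ʳ; ∈-map⁺; ∈-concat⁺′; ∈-cartesianProductWith⁺; ∈-cartesianProductWith⁻; ∈-deduplicate⁺)
open import Data.List.Membership.Propositional.Properties.WithK using (unique∧set⇒bag)
open import Data.List.Relation.Unary.Any using (here; there)
import Data.List.Relation.Unary.All as All
import Data.List.Relation.Unary.All.Properties as All
open import Data.List.Relation.Unary.AllPairs using ([]; _∷_)
import Data.List.Relation.Unary.AllPairs as AllPairs
import Data.List.Relation.Unary.AllPairs.Properties as AllPairs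
open import Data.List.Relation.Unary.Unique.Propositional using (Unique)
import Data.List.Relation.Unary.Unique.Propositional.Properties as Unique
open import Data.List.Relation.Unary.Unique.DecPropositional.Properties _≟_ using (deduplicate-!)
open import Data.List.Relation.Binary.Disjoint.Propositional using (Disjoint)
open import Data.List.Relation.Binary.Permutation.Propositional using (_↭_; ↭⇒↭ₛ)
open import Data.List.Relation.Binary.Permutation.Propositional.Properties
  using (↭-reverse) renaming (map⁺ to ↭-map⁺)
open import Data.List.Relation.Binary.Permutation.Setoid.Properties using (foldr-commMonoid)
open import Data.List.Relation.Binary.BagAndSetEquality using (∼bag⇒↭)
open import Data.Product using (∃-syntax; _,_; _×_)
open import Data.Sum using (_⊎_; inj₁; inj₂)
open import Function using (_∘_)
open import Function.Bundles using (mk⇔)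
open import Relation.Nullary using (yes; no)
open import Data.Empty using (⊥-elim)
open import Relation.Binary.PropositionalEquality
  using (_≡_; _≢_; refl; sym; trans; cong; cong₂; subst; module ≡-Reasoning)

open ≡-Reasoning
open +-*-Solver using (solve; _:+_; _:*_; _:=_)

private
  variable
    A B C : Set
    n : ℕ

sumℚ-++ : ∀ xs ys → sumℚ (xs ++ ys) ≡ sumℚ xs + sumℚ ys
sumℚ-++ []       ys = sym (ℚₚ.+-identityˡ _)
sumℚ-++ (x ∷ xs) ys = trans (cong (x +_) (sumℚ-++ xs ys)) (sym (ℚₚ.+-assoc x _ _))

productℚ-++ : ∀ xs ys → productℚ (xs ++ ys) ≡ productℚ xs * productℚ ys
productℚ-++ []       ys = sym (ℚₚ.*-identityˡ _)
productℚ-++ (x ∷ xs) ys = trans (cong (x *_) (productℚ-++ xs ys)) (sym (ℚₚ.*-assoc x _ _))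

sumℚ-↭ : ∀ {xs ys} → xs ↭ ys → sumℚ xs ≡ sumℚ ys
sumℚ-↭ p = foldr-commMonoid +-0.setoid +-0.isCommutativeMonoid (↭⇒↭ₛ p)
  where module +-0 = CommutativeMonoid ℚₚ.+-0-commutativeMonoid

sumℚ-*ˡ : ∀ c (f : A → ℚ) xs → sumℚ (map (λ x → c * f x) xs) ≡ c * sumℚ (map f xs)
sumℚ-*ˡ c f []       = sym (ℚₚ.*-zeroʳ c)
sumℚ-*ˡ c f (x ∷ xs) = trans (cong (c * f x +_) (sumℚ-*ˡ c f xs)) (sym (ℚₚ.*-distribˡ-+ c _ _))

sumℚ-concatMap : ∀ (h : B → ℚ) (g : A → List B) xs →
  sumℚ (map h (concatMap g xs)) ≡ sumℚ (map (λ x → sumℚ (map h (g x))) xs)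
sumℚ-concatMap h g []       = refl
sumℚ-concatMap h g (x ∷ xs) = begin
  sumℚ (map h (g x ++ concatMap g xs))                   ≡⟨ cong sumℚ (map-++ h (g x) _) ⟩
  sumℚ (map h (g x) ++ map h (concatMap g xs))           ≡⟨ sumℚ-++ (map h (g x)) _ ⟩
  sumℚ (map h (g x)) + sumℚ (map h (concatMap g xs))     ≡⟨ cong (sumℚ (map h (g x)) +_) (sumℚ-concatMap h g xs) ⟩
  sumℚ (map h (g x)) + sumℚ (map (λ x → sumℚ (map h (g x))) xs) ∎

sumℚ-cartesianProductWith : ∀ (f : A → B → C) (h : C → ℚ) (g₁ : A → ℚ) (g₂ : B → ℚ) c →
  (∀ x y → h (f x y) ≡ c * (g₁ x * g₂ y)) → ∀ xs ys →
  sumℚ (map h (cartesianProductWith f xs ys)) ≡ c * (sumℚ (map g₁ xs) * sumℚ (map g₂ ys))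
sumℚ-cartesianProductWith f h g₁ g₂ c hf []       ys =
  sym (trans (cong (c *_) (ℚₚ.*-zeroˡ (sumℚ (map g₂ ys)))) (ℚₚ.*-zeroʳ c))
sumℚ-cartesianProductWith f h g₁ g₂ c hf (x ∷ xs) ys = begin
  sumℚ (map h (map (f x) ys ++ cartesianProductWith f xs ys))
    ≡⟨ cong sumℚ (map-++ h (map (f x) ys) _) ⟩
  sumℚ (map h (map (f x) ys) ++ map h (cartesianProductWith f xs ys))
    ≡⟨ sumℚ-++ (map h (map (f x) ys)) _ ⟩
  sumℚ (map h (map (f x) ys)) + sumℚ (map h (cartesianProductWith f xs ys))
    ≡⟨ cong₂ _+_ row (sumℚ-cartesianProductWith f h g₁ g₂ c hf xs ys) ⟩
  c * (g₁ x * Σ₂) + c * (Σ₁ * Σ₂)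
    ≡⟨ solve 4 (λ c X S₁ S₂ → c :* (X :* S₂) :+ c :* (S₁ :* S₂) := c :* ((X :+ S₁) :* S₂))
               refl c (g₁ x) Σ₁ Σ₂ ⟩
  c * ((g₁ x + Σ₁) * Σ₂) ∎
  where
  Σ₁ = sumℚ (map g₁ xs)
  Σ₂ = sumℚ (map g₂ ys)
  row : sumℚ (map h (map (f x) ys)) ≡ c * (g₁ x * Σ₂)
  row = begin
    sumℚ (map h (map (f x) ys))               ≡⟨ cong sumℚ (sym (map-∘ ys)) ⟩
    sumℚ (map (h ∘ f x) ys)                   ≡⟨ cong sumℚ (map-cong (hf x) ys) ⟩
    sumℚ (map (λ y → c * (g₁ x * g₂ y)) ys)   ≡⟨ sumℚ-*ˡ c (λ y → g₁ x * g₂ y) ys ⟩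
    c * sumℚ (map (λ y → g₁ x * g₂ y) ys)     ≡⟨ cong (c *_) (sumℚ-*ˡ (g₁ x) g₂ ys) ⟩
    c * (g₁ x * Σ₂)                           ∎

multiplicity : ℕ → List ℕ → ℕ
multiplicity u xs = length (filter (_≟ u) xs)

multiplicity-∷-≡ : ∀ x xs → multiplicity x (x ∷ xs) ≡ suc (multiplicity x xs)
multiplicity-∷-≡ x xs = cong length (filter-accept (_≟ x) refl)

multiplicity-∷-≢ : ∀ {x u} xs → x ≢ u → multiplicity u (x ∷ xs) ≡ multiplicity u xs
multiplicity-∷-≢ {u = u} xs x≢u = cong length (filter-reject (_≟ u) x≢u)

productℚ-powers-multiplicity : ∀ (f : ℕ → ℚ) xs {ys} → Unique ys → (∀ {x} → x ∈ xs → x ∈ ys) →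
  productℚ (map (λ u → f u ^ℚ multiplicity u xs) ys) ≡ productℚ (map f xs)
productℚ-powers-multiplicity f [] {ys} _ _ = productℚ-ones ys
  where
  productℚ-ones : ∀ ys → productℚ (map (λ _ → 1ℚ) ys) ≡ 1ℚ
  productℚ-ones []       = refl
  productℚ-ones (_ ∷ ys) = trans (ℚₚ.*-identityˡ _) (productℚ-ones ys)
productℚ-powers-multiplicity f (x ∷ xs) ys! xs⊆ys =
  trans (extract ys! (xs⊆ys (here refl)))
        (cong (f x *_) (productℚ-powers-multiplicity f xs ys! (xs⊆ys ∘ there)))
  where
  powers : List ℕ → List ℕ → ℚ
  powers zs ys = productℚ (map (λ u → f u ^ℚ multiplicity u zs) ys)
  extract : ∀ {ys} → Unique ys → x ∈ ys → powers (x ∷ xs) ys ≡ f x * powers xs ys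
  extract {y ∷ ys} (y∉ys ∷ _) (here refl) = begin
    f y ^ℚ multiplicity y (y ∷ xs) * powers (y ∷ xs) ys
      ≡⟨ cong₂ (λ m p → f y ^ℚ m * p) (multiplicity-∷-≡ y xs)
               (cong productℚ (map-cong-local (All.map (cong (f _ ^ℚ_) ∘ multiplicity-∷-≢ xs) y∉ys))) ⟩
    f y * f y ^ℚ multiplicity y xs * powers xs ys
      ≡⟨ ℚₚ.*-assoc (f y) _ _ ⟩
    f y * (f y ^ℚ multiplicity y xs * powers xs ys) ∎
  extract {y ∷ ys} (y∉ys ∷ ys!) (there x∈ys) = begin
    f y ^ℚ multiplicity y (x ∷ xs) * powers (x ∷ xs) ys
      ≡⟨ cong₂ _*_ (cong (f y ^ℚ_) (multiplicity-∷-≢ xs (All.lookup y∉ys x∈ys ∘ sym)))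
                   (extract ys! x∈ys) ⟩
    f y ^ℚ multiplicity y xs * (f x * powers xs ys)
      ≡⟨ solve 3 (λ P X Q → P :* (X :* Q) := X :* (P :* Q))
                 refl (f y ^ℚ multiplicity y xs) (f x) (powers xs ys) ⟩
    f x * (f y ^ℚ multiplicity y xs * powers xs ys) ∎

sumUpTo : ℕ → (ℕ → ℚ) → ℚ
sumUpTo n F = sumℚ (applyUpTo F n)

sumUpTo-+ : ∀ p q F → sumUpTo (p ℕ.+ q) F ≡ sumUpTo p F + sumUpTo q (λ i → F (p ℕ.+ i))
sumUpTo-+ zero    q F = sym (ℚₚ.+-identityˡ _)
sumUpTo-+ (suc p) q F =
  trans (cong (F 0 +_) (sumUpTo-+ p q (F ∘ suc))) (sym (ℚₚ.+-assoc (F 0) _ _))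

sumUpTo-reflect : ∀ n F G → (∀ i j → suc (i ℕ.+ j) ≡ n → F i ≡ G j) → sumUpTo n F ≡ sumUpTo n G
sumUpTo-reflect n F G F≡G = begin
  sumℚ (applyUpTo F n)             ≡⟨ upTo≡downFrom n F F≡G ⟩
  sumℚ (applyDownFrom G n)         ≡⟨ cong sumℚ (reverse-applyUpTo G n) ⟨
  sumℚ (reverse (applyUpTo G n))   ≡⟨ sumℚ-↭ (↭-reverse (applyUpTo G n)) ⟩
  sumℚ (applyUpTo G n)             ∎
  where
  upTo≡downFrom : ∀ n F → (∀ i j → suc (i ℕ.+ j) ≡ n → F i ≡ G j) →
    sumℚ (applyUpTo F n) ≡ sumℚ (applyDownFrom G n)
  upTo≡downFrom zero    F _   = refl
  upTo≡downFrom (suc n) F F≡G = begin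
    F 0 + sumℚ (applyUpTo (F ∘ suc) n)
      ≡⟨ cong (F 0 +_) (upTo≡downFrom n (F ∘ suc) λ i j e → F≡G (suc i) j (cong suc e)) ⟩
    F 0 + sumℚ (applyDownFrom G n)
      ≡⟨ cong (_+ sumℚ (applyDownFrom G n)) (F≡G 0 n refl) ⟩
    G n + sumℚ (applyDownFrom G n) ∎

sumUpTo-palindrome : ∀ h c {n} F → h ℕ.+ c ℕ.+ h ≡ n → (∀ i j → suc (i ℕ.+ j) ≡ n → F i ≡ F j) →
  sumUpTo n F ≡ sumUpTo c (λ i → F (h ℕ.+ i)) + (sumUpTo h F + sumUpTo h F)
sumUpTo-palindrome h c F refl F-sym = begin
  sumUpTo (h ℕ.+ c ℕ.+ h) F
    ≡⟨ sumUpTo-+ (h ℕ.+ c) h F ⟩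
  sumUpTo (h ℕ.+ c) F + sumUpTo h (λ i → F (h ℕ.+ c ℕ.+ i))
    ≡⟨ cong₂ _+_ (sumUpTo-+ h c F) (sumUpTo-reflect h _ F upper≡lower) ⟩
  S + M + S
    ≡⟨ solve 2 (λ S M → S :+ M :+ S := M :+ (S :+ S)) refl S M ⟩
  M + (S + S) ∎
  where
  S = sumUpTo h F
  M = sumUpTo c (λ i → F (h ℕ.+ i))
  upper≡lower : ∀ i j → suc (i ℕ.+ j) ≡ h → F (h ℕ.+ c ℕ.+ i) ≡ F j
  upper≡lower i j e = F-sym (h ℕ.+ c ℕ.+ i) j (begin
    suc (h ℕ.+ c ℕ.+ i ℕ.+ j)  ≡⟨ cong suc (ℕₚ.+-assoc (h ℕ.+ c) i j) ⟩
    suc (h ℕ.+ c ℕ.+ (i ℕ.+ j)) ≡⟨ ℕₚ.+-suc (h ℕ.+ c) (i ℕ.+ j) ⟨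
    h ℕ.+ c ℕ.+ suc (i ℕ.+ j)   ≡⟨ cong (h ℕ.+ c ℕ.+_) e ⟩
    h ℕ.+ c ℕ.+ h               ∎)

-- The possible label pairs (l + 1, r + 1) of the two children of a node labelled n.
data Split : ℕ → Set where
  split : ∀ l r → Split (suc l ℕ.+ suc r)

left : Split n → ℕ
left (split l r) = l

split-sucˡ : Split n → Split (suc n)
split-sucˡ (split l r) = split (suc l) r

splits : (n : ℕ) → List (Split n)
splits zero          = []
splits (suc zero)    = []
splits (suc (suc r)) = split 0 r ∷ map split-sucˡ (splits (suc r))

split-∈-splits : ∀ l r → split l r ∈ splits (suc l ℕ.+ suc r)
split-∈-splits zero    r = here refl
split-∈-splits (suc l) r = there (∈-map⁺ split-sucˡ (split-∈-splits l r))

map-left-splits : ∀ n → map left (splits n) ≡ upTo (pred n)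
map-left-splits zero          = refl
map-left-splits (suc zero)    = refl
map-left-splits (suc (suc r)) = cong (0 ∷_) (begin
  map left (map split-sucˡ (splits (suc r)))  ≡⟨ map-∘ (splits (suc r)) ⟨
  map (left ∘ split-sucˡ) (splits (suc r))    ≡⟨ map-cong left-sucˡ (splits (suc r)) ⟩
  map (suc ∘ left) (splits (suc r))           ≡⟨ map-∘ (splits (suc r)) ⟩
  map suc (map left (splits (suc r)))         ≡⟨ cong (map suc) (map-left-splits (suc r)) ⟩
  map suc (upTo r)                            ≡⟨ map-upTo suc r ⟩
  applyUpTo suc r                             ∎)
  where
  left-sucˡ : ∀ {n} (s : Split n) → left (split-sucˡ s) ≡ suc (left s)
  left-sucˡ (split l r) = refl

splits-left-distinct : ∀ n → AllPairs.AllPairs (λ s s′ → left s ≢ left s′) (splits n)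
splits-left-distinct n =
  AllPairs.map⁻ (subst Unique (sym (map-left-splits n)) (Unique.upTo⁺ (pred n)))

splitProduct : (ℕ → ℚ) → (ℕ → ℚ) → Split n → ℚ
splitProduct f g (split l r) = f (suc l) * g (suc r)

convolution : (ℕ → ℚ) → ℕ → ℚ
convolution f n = sumℚ (map (splitProduct f f) (splits n))

convolution-cong : ∀ {f g} n → (∀ k → k < n → f k ≡ g k) → convolution f n ≡ convolution g n
convolution-cong {f} {g} n f≡g = cong sumℚ (map-cong splitProduct-cong (splits n))
  where
  splitProduct-cong : (s : Split n) → splitProduct f f s ≡ splitProduct g g s
  splitProduct-cong (split l r) =
    cong₂ _*_ (f≡g (suc l) (ℕₚ.m<m+n (suc l) (s≤s z≤n))) (f≡g (suc r) (ℕₚ.m<n+m (suc r) (s≤s z≤n)))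

convolutionTerm : (ℕ → ℚ) → ℕ → ℕ → ℚ
convolutionTerm f m i = f (suc i) * f (suc m ∸ i)

convolutionTerm-sym : ∀ f m i j → suc (i ℕ.+ j) ≡ suc m → convolutionTerm f m i ≡ convolutionTerm f m j
convolutionTerm-sym f m i j refl = begin
  f (suc i) * f (suc (i ℕ.+ j) ∸ i)  ≡⟨ cong (λ k → f (suc i) * f k) (ℕₚ.+-∸-assoc 1 (ℕₚ.m≤m+n i j)) ⟩
  f (suc i) * f (suc (i ℕ.+ j ∸ i))  ≡⟨ cong (λ k → f (suc i) * f (suc k)) (ℕₚ.m+n∸m≡n i j) ⟩
  f (suc i) * f (suc j)              ≡⟨ ℚₚ.*-comm (f (suc i)) (f (suc j)) ⟩
  f (suc j) * f (suc i)              ≡⟨ cong (λ k → f (suc j) * f (suc k)) (ℕₚ.m+n∸n≡m i j) ⟨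
  f (suc j) * f (suc (i ℕ.+ j ∸ j))  ≡⟨ cong (λ k → f (suc j) * f k) (ℕₚ.+-∸-assoc 1 (ℕₚ.m≤n+m j i)) ⟨
  f (suc j) * f (suc (i ℕ.+ j) ∸ j)  ∎

sum-splitProduct : ∀ m f g →
  sumℚ (map (splitProduct f g) (splits (suc (suc m)))) ≡ sumUpTo (suc m) (λ i → f (suc i) * g (suc m ∸ i))
sum-splitProduct zero    f g = refl
sum-splitProduct (suc m) f g = cong (f 1 * g (suc (suc m)) +_) (begin
  sumℚ (map (splitProduct f g) (map split-sucˡ (splits (suc (suc m)))))
    ≡⟨ cong sumℚ (map-∘ {g = splitProduct f g} {f = split-sucˡ} (splits (suc (suc m)))) ⟨
  sumℚ (map (splitProduct f g ∘ split-sucˡ) (splits (suc (suc m))))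
    ≡⟨ cong sumℚ (map-cong splitProduct-sucˡ (splits (suc (suc m)))) ⟩
  sumℚ (map (splitProduct (f ∘ suc) g) (splits (suc (suc m))))
    ≡⟨ sum-splitProduct m (f ∘ suc) g ⟩
  sumUpTo (suc m) (λ i → f (suc (suc i)) * g (suc m ∸ i)) ∎)
  where
  splitProduct-sucˡ : ∀ {n} (s : Split n) → splitProduct f g (split-sucˡ s) ≡ splitProduct (f ∘ suc) g s
  splitProduct-sucˡ (split l r) = refl

even-or-odd : ∀ m → ∃[ j ] (m ≡ j ℕ.* 2 ⊎ m ≡ suc (j ℕ.* 2))
even-or-odd m with m % 2 | m%n<n m 2 | m≡m%n+[m/n]*n m 2
... | 0           | _            | m≡ = m / 2 , inj₁ m≡
... | 1           | _            | m≡ = m / 2 , inj₂ m≡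
... | suc (suc _) | s≤s (s≤s ()) | _

[1+j*2]/2≡j : ∀ j → suc (j ℕ.* 2) / 2 ≡ j
[1+j*2]/2≡j zero    = refl
[1+j*2]/2≡j (suc j) =
  trans (m/n≡1+[m∸n]/n {suc (suc (suc (j ℕ.* 2)))} (s≤s (s≤s z≤n))) (cong suc ([1+j*2]/2≡j j))

j+[1+j]≡1+j*2 : ∀ j → j ℕ.+ suc j ≡ suc (j ℕ.* 2)
j+[1+j]≡1+j*2 = solve-∀

j+1+j≡1+j*2 : ∀ j → j ℕ.+ 1 ℕ.+ j ≡ suc (j ℕ.* 2)
j+1+j≡1+j*2 = solve-∀

[1+j]+0+[1+j]≡2+j*2 : ∀ j → suc j ℕ.+ 0 ℕ.+ suc j ≡ suc (suc (j ℕ.* 2))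
[1+j]+0+[1+j]≡2+j*2 = solve-∀

two : ℚ
two = ℤ.+ 2 ℚ./ 1

two*q≡q+q : ∀ q → two * q ≡ q + q
two*q≡q+q q = trans (ℚₚ.*-distribʳ-+ q 1ℚ 1ℚ) (cong₂ _+_ (ℚₚ.*-identityˡ q) (ℚₚ.*-identityˡ q))

sumℚ-range1 : ∀ (G : ℕ → ℚ) h → sumℚ (map G (range1 h)) ≡ sumUpTo h (G ∘ suc)
sumℚ-range1 G h = cong sumℚ (trans (sym (map-∘ (upTo h))) (map-upTo (G ∘ suc) h))

evenTerm : ℕ → (ℕ → ℚ) → ℚ
evenTerm k f with k % 2 ≟ 0
... | yes _ = f (k / 2) * f (k / 2)
... | no _  = 0ℚ

evenTerm-even : ∀ j f → evenTerm (suc j ℕ.* 2) f ≡ f (suc j) * f (suc j)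
evenTerm-even j f with suc j ℕ.* 2 % 2 ≟ 0
... | yes _ = cong (λ h → f h * f h) (m*n/n≡m (suc j) 2)
... | no ≢0 = ⊥-elim (≢0 (m*n%n≡0 (suc j) 2))

evenTerm-odd : ∀ j f → evenTerm (suc (j ℕ.* 2)) f ≡ 0ℚ
evenTerm-odd j f with suc (j ℕ.* 2) % 2 ≟ 0
... | yes ≡0 = ⊥-elim (ℕₚ.1+n≢0 (trans (sym ([m+kn]%n≡m%n 1 j 2)) ≡0))
... | no _   = refl

step-unfold : ∀ m f → step (suc (suc m)) f ≡
  b (suc (suc m)) *
    (evenTerm (suc (suc m)) f + two * sumℚ (map (λ s → f s * f (suc (suc m) ∸ s)) (range1 (suc m / 2))))
step-unfold m f with suc (suc m) % 2 ≟ 0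
... | yes _ = refl
... | no _  = refl

convolution-fold : ∀ m f →
  evenTerm (suc (suc m)) f + two * sumUpTo (suc m / 2) (convolutionTerm f m) ≡ sumUpTo (suc m) (convolutionTerm f m)
convolution-fold m f with even-or-odd m
... | j , inj₁ refl = begin
  evenTerm (suc (suc m)) f + two * sumUpTo (suc m / 2) F
    ≡⟨ cong₂ (λ x h → x + two * sumUpTo h F) (evenTerm-even j f) ([1+j*2]/2≡j j) ⟩
  f (suc j) * f (suc j) + two * sumUpTo j F
    ≡⟨ cong₂ _+_ middle (two*q≡q+q (sumUpTo j F)) ⟩
  sumUpTo 1 (λ i → F (j ℕ.+ i)) + (sumUpTo j F + sumUpTo j F)
    ≡⟨ sumUpTo-palindrome j 1 F (j+1+j≡1+j*2 j) (convolutionTerm-sym f m) ⟨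
  sumUpTo (suc m) F ∎
  where
  F = convolutionTerm f m
  middle : f (suc j) * f (suc j) ≡ F (j ℕ.+ 0) + 0ℚ
  middle = begin
    f (suc j) * f (suc j)              ≡⟨ cong (λ h → f (suc j) * f h) (ℕₚ.m+n∸m≡n j (suc j)) ⟨
    f (suc j) * f (j ℕ.+ suc j ∸ j)    ≡⟨ cong (λ h → f (suc j) * f (h ∸ j)) (j+[1+j]≡1+j*2 j) ⟩
    F j                                ≡⟨ cong F (ℕₚ.+-identityʳ j) ⟨
    F (j ℕ.+ 0)                        ≡⟨ ℚₚ.+-identityʳ (F (j ℕ.+ 0)) ⟨
    F (j ℕ.+ 0) + 0ℚ                   ∎
... | j , inj₂ refl = begin
  evenTerm (suc (suc m)) f + two * sumUpTo (suc m / 2) F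
    ≡⟨ cong₂ (λ x h → x + two * sumUpTo h F) (evenTerm-odd (suc j) f) (m*n/n≡m (suc j) 2) ⟩
  0ℚ + two * sumUpTo (suc j) F
    ≡⟨ cong (0ℚ +_) (two*q≡q+q (sumUpTo (suc j) F)) ⟩
  0ℚ + (sumUpTo (suc j) F + sumUpTo (suc j) F)
    ≡⟨ sumUpTo-palindrome (suc j) 0 F ([1+j]+0+[1+j]≡2+j*2 j) (convolutionTerm-sym f m) ⟨
  sumUpTo (suc m) F ∎
  where
  F = convolutionTerm f m

step-convolution : ∀ m f → step (suc (suc m)) f ≡ b (suc (suc m)) * convolution f (suc (suc m))
step-convolution m f = begin
  step k f
    ≡⟨ step-unfold m f ⟩
  b k * (evenTerm k f + two * sumℚ (map (λ s → f s * f (k ∸ s)) (range1 (suc m / 2))))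
    ≡⟨ cong (λ x → b k * (evenTerm k f + two * x)) (sumℚ-range1 (λ s → f s * f (k ∸ s)) (suc m / 2)) ⟩
  b k * (evenTerm k f + two * sumUpTo (suc m / 2) (convolutionTerm f m))
    ≡⟨ cong (b k *_) (convolution-fold m f) ⟩
  b k * sumUpTo (suc m) (convolutionTerm f m)
    ≡⟨ cong (b k *_) (sum-splitProduct m f f) ⟨
  b k * convolution f k ∎
  where
  k = suc (suc m)

a-suc : ∀ n → a (suc n) ≡ step (suc n) (aTab n)
a-suc n with suc n ≤? n
... | yes n<n = ⊥-elim (ℕₚ.<-irrefl refl n<n)
... | no _    = refl

aTab≡a : ∀ {n i} → i ≤ n → aTab n i ≡ a i
aTab≡a {zero}  z≤n = refl
aTab≡a {suc n} {i} i≤1+n with i ≤? n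
... | yes i≤n = aTab≡a i≤n
... | no i≰n with ℕₚ.≤-antisym i≤1+n (ℕₚ.≰⇒> i≰n)
...   | refl = sym (a-suc n)

a-recursion : ∀ m → a (suc (suc m)) ≡ b (suc (suc m)) * convolution a (suc (suc m))
a-recursion m = begin
  a (suc (suc m))                                   ≡⟨ a-suc (suc m) ⟩
  step (suc (suc m)) (aTab (suc m))                 ≡⟨ step-convolution m (aTab (suc m)) ⟩
  b (suc (suc m)) * convolution (aTab (suc m)) (suc (suc m))
    ≡⟨ cong (b (suc (suc m)) *_) (convolution-cong (suc (suc m)) (λ _ k<2+m → aTab≡a (ℕₚ.≤-pred k<2+m))) ⟩
  b (suc (suc m)) * convolution a (suc (suc m))     ∎

nodeProduct : ∀ {v} → Tree v → ℚ
nodeProduct t = productℚ (map b (labels t))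

weight≡nodeProduct : ∀ {v} (t : Tree v) → weight t ≡ nodeProduct t
weight≡nodeProduct t =
  productℚ-powers-multiplicity b (labels t) (deduplicate-! (labels t)) (∈-deduplicate⁺ _≟_)

nodeProduct-node : ∀ {l r} (x : Tree (suc l)) (y : Tree (suc r)) →
  nodeProduct (node x y) ≡ b (suc l ℕ.+ suc r) * (nodeProduct x * nodeProduct y)
nodeProduct-node {l} {r} x y = cong (b (suc l ℕ.+ suc r) *_)
  (trans (cong productℚ (map-++ b (labels x) (labels y))) (productℚ-++ (map b (labels x)) _))

treeSum : List (Tree n) → ℚ
treeSum ts = sumℚ (map nodeProduct ts)

leaves : (n : ℕ) → List (Tree n)
leaves zero          = []
leaves (suc zero)    = leaf ∷ []
leaves (suc (suc _)) = []

joins : (∀ k → List (Tree k)) → Split n → List (Tree n)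
joins L (split l r) = cartesianProductWith node (L (suc l)) (L (suc r))

-- The first argument is fuel: the list enumerates all of 𝒯_n once n ≤ fuel.
treesWithin : ℕ → (n : ℕ) → List (Tree n)
treesWithin zero    n = []
treesWithin (suc f) n = leaves n ++ concatMap (joins (treesWithin f)) (splits n)

∈-treesWithin : ∀ {f n} (t : Tree n) → n ≤ f → t ∈ treesWithin f n
∈-treesWithin {suc f} leaf _ = here refl
∈-treesWithin {suc f} {n} (node {l} {r} x y) (s≤s n≤f) =
  ∈-++⁺ʳ (leaves n) (∈-concat⁺′
    (∈-cartesianProductWith⁺ node (∈-treesWithin x 1+l≤f) (∈-treesWithin y 1+r≤f))
    (∈-map⁺ (joins (treesWithin f)) (split-∈-splits l r)))
  where
  1+l≤f : suc l ≤ f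
  1+l≤f = ℕₚ.≤-trans (ℕₚ.m≤m+n (suc l) r) (ℕₚ.≤-trans (ℕₚ.≤-reflexive (sym (ℕₚ.+-suc l r))) n≤f)
  1+r≤f : suc r ≤ f
  1+r≤f = ℕₚ.≤-trans (ℕₚ.m≤n+m (suc r) l) n≤f

leftSize : Tree n → ℕ
leftSize leaf           = 0  -- junk: a leaf has no children
leftSize (node {l} _ _) = l

leftSize-joins : ∀ {L} (s : Split n) {t} → t ∈ joins L s → leftSize t ≡ left s
leftSize-joins {L = L} (split l r) t∈ with ∈-cartesianProductWith⁻ node (L (suc l)) (L (suc r)) t∈
... | _ , _ , _ , _ , refl = refl

joins-unique : ∀ {L} → (∀ k → Unique (L k)) → (s : Split n) → Unique (joins L s)
joins-unique L! (split l r) = Unique.cartesianProductWith⁺ node node-injective (L! (suc l)) (L! (suc r))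
  where
  node-injective : ∀ {x x′ y y′} → node {l} {r} x y ≡ node x′ y′ → x ≡ x′ × y ≡ y′
  node-injective refl = refl , refl

concatMap-joins-unique : ∀ {L} → (∀ k → Unique (L k)) → ∀ n → Unique (concatMap (joins L) (splits n))
concatMap-joins-unique {L} L! n = Unique.concat⁺
  (All.map⁺ (All.tabulate λ {s} _ → joins-unique L! s))
  (AllPairs.map⁺ (AllPairs.map (λ {s} {s′} → disjoint {s} {s′}) (splits-left-distinct n)))
  where
  disjoint : ∀ {s s′ : Split n} → left s ≢ left s′ → Disjoint (joins L s) (joins L s′)
  disjoint {s} {s′} ≢ (t∈s , t∈s′) = ≢ (trans (sym (leftSize-joins s t∈s)) (leftSize-joins s′ t∈s′))

treesWithin-unique : ∀ f n → Unique (treesWithin f n)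
treesWithin-unique zero    n             = []
treesWithin-unique (suc f) zero          = []
treesWithin-unique (suc f) (suc zero)    = All.[] ∷ []
treesWithin-unique (suc f) (suc (suc m)) = concatMap-joins-unique (treesWithin-unique f) (suc (suc m))

treeSum-joins : ∀ L (s : Split n) →
  treeSum (joins L s) ≡ b n * splitProduct (λ k → treeSum (L k)) (λ k → treeSum (L k)) s
treeSum-joins L (split l r) =
  sumℚ-cartesianProductWith node nodeProduct nodeProduct nodeProduct (b (suc l ℕ.+ suc r)) nodeProduct-node
    (L (suc l)) (L (suc r))

treeSum-concatMap-joins : ∀ L n →
  treeSum (concatMap (joins L) (splits n)) ≡ b n * convolution (λ k → treeSum (L k)) n
treeSum-concatMap-joins L n = begin
  treeSum (concatMap (joins L) (splits n))
    ≡⟨ sumℚ-concatMap nodeProduct (joins L) (splits n) ⟩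
  sumℚ (map (λ s → treeSum (joins L s)) (splits n))
    ≡⟨ cong sumℚ (map-cong (treeSum-joins L) (splits n)) ⟩
  sumℚ (map (λ s → b n * splitProduct T T s) (splits n))
    ≡⟨ sumℚ-*ˡ (b n) (splitProduct T T) (splits n) ⟩
  b n * convolution T n ∎
  where
  T : ℕ → ℚ
  T k = treeSum (L k)

treeSum-treesWithin : ∀ f n → n ≤ f → treeSum (treesWithin f n) ≡ a n
treeSum-treesWithin zero    zero          _ = refl
treeSum-treesWithin (suc f) zero          _ = refl
treeSum-treesWithin (suc f) (suc zero)    _ = refl
treeSum-treesWithin (suc f) (suc (suc m)) (s≤s 1+m≤f) = begin
  treeSum (concatMap (joins (treesWithin f)) (splits (suc (suc m))))
    ≡⟨ treeSum-concatMap-joins (treesWithin f) (suc (suc m)) ⟩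
  b (suc (suc m)) * convolution (λ k → treeSum (treesWithin f k)) (suc (suc m))
    ≡⟨ cong (b (suc (suc m)) *_) (convolution-cong (suc (suc m)) λ k k<2+m →
         treeSum-treesWithin f k (ℕₚ.≤-trans (ℕₚ.≤-pred k<2+m) 1+m≤f)) ⟩
  b (suc (suc m)) * convolution a (suc (suc m))
    ≡⟨ a-recursion m ⟨
  a (suc (suc m)) ∎

treeSum-enumeration : ∀ n (ts : List (Tree n)) → Unique ts → (∀ t → t ∈ ts) → treeSum ts ≡ a n
treeSum-enumeration n ts ts! ts-complete = begin
  treeSum ts                    ≡⟨ sumℚ-↭ (↭-map⁺ nodeProduct ts↭trees) ⟩
  treeSum (treesWithin n n)     ≡⟨ treeSum-treesWithin n n ℕₚ.≤-refl ⟩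
  a n                           ∎
  where
  ts↭trees : ts ↭ treesWithin n n
  ts↭trees = ∼bag⇒↭ (unique∧set⇒bag ts! (treesWithin-unique n n)
    (λ {t} → mk⇔ (λ _ → ∈-treesWithin t ℕₚ.≤-refl) (λ _ → ts-complete t)))

proposition3p5 : (k : ℕ) → k ≥ 1 → (ts : List (Tree k)) →
    Unique ts → (∀ t → t ∈ ts) →
    a k ≡ sumℚ (map weight ts)
proposition3p5 k _ ts ts! ts-complete = begin
  a k                     ≡⟨ treeSum-enumeration k ts ts! ts-complete ⟨
  treeSum ts              ≡⟨ cong sumℚ (map-cong weight≡nodeProduct ts) ⟨
  sumℚ (map weight ts)    ∎
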